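{- Let $H$ be a Heyting algebra. The term $x\#y:=\neg(x\leftrightarrow y)$ is an apartness term in $H$ if and only if $H$ satisfies the weak law of excluded middle, i.e. $\neg x\vee\neg\neg x=\top$ for all $x\in H$.
   Context: A Heyting algebra is a bounded distributive lattice $\langle H,\wedge,\vee,\rightarrow,\bot,\top\rangle$ in which $a\rightarrow b$ is the largest $c$ with $a\wedge c\le b$; write $\neg a$ for $a\rightarrow\bot$ and $a\leftrightarrow b$ for $(a\rightarrow b)\wedge(b\rightarrow a)$. A term $x\# y$ in two free variables is an apartness term in $H$ if for all $x,y,z\in H$: $x\#x=\bot$; $x\#y=y\#x$; $x\#y\le (x\#z)\vee(z\#y)$. -}

module Defs where

open import Level using (Level)
open import Data.Product using (_×_)
open import Relation.Binary.Lattice.Bundles using (HeytingAlgebra)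

module _ {c ℓ₁ ℓ₂ : Level} (H : HeytingAlgebra c ℓ₁ ℓ₂) where
  open HeytingAlgebra H

  neg : Carrier → Carrier
  neg a = a ⇨ ⊥

  biimp : Carrier → Carrier → Carrier
  biimp a b = (a ⇨ b) ∧ (b ⇨ a)

  sharp : Carrier → Carrier → Carrier
  sharp x y = neg (biimp x y)

  IsApartnessTerm : (Carrier → Carrier → Carrier) → Set (c Level.⊔ ℓ₁ Level.⊔ ℓ₂)
  IsApartnessTerm t =
    (∀ x → t x x ≈ ⊥) ×
    (∀ x y → t x y ≈ t y x) ×
    (∀ x y z → t x y ≤ (t x z ∨ t z y))

  WeakExcludedMiddle : Set (c Level.⊔ ℓ₁)
  WeakExcludedMiddle = ∀ x → (neg x ∨ neg (neg x)) ≈ ⊤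

{-# OPTIONS --safe #-}
module Submission where

-- Modulo the identities ⊤ ↔ x = x and x ↔ ⊥ = ¬ x, cotransitivity of # at the
-- triple (⊤, ⊥, x) says exactly ⊤ ≤ ¬ x ∨ ¬¬ x. Conversely, the weak law of
-- excluded middle yields the De Morgan law ¬ (a ∧ b) ≤ ¬ a ∨ ¬ b, and
-- cotransitivity of # is its instance at a = x ↔ z, b = z ↔ y, because
-- (x ↔ z) ∧ (z ↔ y) ≤ x ↔ y.

open import Defs
open import Level using (Level)
open import Data.Product using (_,_)
open import Function.Bundles using (_⇔_; mk⇔)
open import Relation.Binary.Lattice.Bundles using (HeytingAlgebra)
import Relation.Binary.Lattice.Properties.HeytingAlgebra as HeytingProperties
import Relation.Binary.Lattice.Properties.MeetSemilattice as MeetProperties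
import Relation.Binary.Lattice.Properties.JoinSemilattice as JoinProperties
import Relation.Binary.Lattice.Properties.BoundedMeetSemilattice as BoundedMeetProperties
import Relation.Binary.Reasoning.PartialOrder as ≤-Reasoning

module HeytingLemmas {c ℓ₁ ℓ₂ : Level} (H : HeytingAlgebra c ℓ₁ ℓ₂) where
  open HeytingAlgebra H
  open HeytingProperties H
  open MeetProperties meetSemilattice using (∧-comm; ∧-assoc; ∧-monotonic; ∧-cong; ∧-idempotent)
  open JoinProperties joinSemilattice using (∨-monotonic)
  open BoundedMeetProperties boundedMeetSemilattice using (identityʳ)
  open ≤-Reasoning poset

  ⊤⇨x≈x : ∀ x → ⊤ ⇨ x ≈ x
  ⊤⇨x≈x x = antisym (trans (∧-greatest refl (maximum _)) ⇨-eval) y≤x⇨y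

  x⇨⊤≈⊤ : ∀ x → x ⇨ ⊤ ≈ ⊤
  x⇨⊤≈⊤ x = antisym (maximum _) y≤x⇨y

  ¬⊤≈⊥ : ¬ ⊤ ≈ ⊥
  ¬⊤≈⊥ = ⊤⇨x≈x ⊥

  ⇨-trans : ∀ x y z → (x ⇨ y) ∧ (y ⇨ z) ≤ x ⇨ z
  ⇨-trans x y z = transpose-⇨ (begin
    ((x ⇨ y) ∧ (y ⇨ z)) ∧ x ≤⟨ ∧-greatest (trans (x∧y≤x _ _) (x∧y≤y _ _))
                                          (∧-monotonic (x∧y≤x _ _) refl) ⟩
    (y ⇨ z) ∧ ((x ⇨ y) ∧ x) ≤⟨ ⇨-applyˡ ⇨-eval ⟩
    z                       ∎)

  ¬∧-elimʳ : ∀ a b → ¬ (a ∧ b) ∧ b ≤ ¬ a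
  ¬∧-elimʳ a b = transpose-⇨ (begin
    (¬ (a ∧ b) ∧ b) ∧ a ≈⟨ ∧-assoc _ _ _ ⟩
    ¬ (a ∧ b) ∧ (b ∧ a) ≤⟨ ⇨-applyˡ (reflexive (∧-comm b a)) ⟩
    ⊥                   ∎)

  ¬∧∧¬¬≤¬ : ∀ a b → ¬ (a ∧ b) ∧ ¬ ¬ a ≤ ¬ b
  ¬∧∧¬¬≤¬ a b = transpose-⇨ (begin
    (¬ (a ∧ b) ∧ ¬ ¬ a) ∧ b ≈⟨ ∧-cong (∧-comm _ _) Eq.refl ⟩
    (¬ ¬ a ∧ ¬ (a ∧ b)) ∧ b ≈⟨ ∧-assoc _ _ _ ⟩
    ¬ ¬ a ∧ (¬ (a ∧ b) ∧ b) ≤⟨ ⇨-applyˡ (¬∧-elimʳ a b) ⟩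
    ⊥                       ∎)

  ¬∧≤¬∨¬ : ∀ {a} b → ¬ a ∨ ¬ ¬ a ≈ ⊤ → ¬ (a ∧ b) ≤ ¬ a ∨ ¬ b
  ¬∧≤¬∨¬ {a} b wem-a = begin
    ¬ (a ∧ b)                              ≤⟨ ∧-greatest refl (trans (maximum _) (reflexive (Eq.sym wem-a))) ⟩
    ¬ (a ∧ b) ∧ (¬ a ∨ ¬ ¬ a)              ≤⟨ ∧-distribˡ-∨-≤ _ _ _ ⟩
    ¬ (a ∧ b) ∧ ¬ a ∨ ¬ (a ∧ b) ∧ ¬ ¬ a    ≤⟨ ∨-monotonic (x∧y≤y _ _) (¬∧∧¬¬≤¬ a b) ⟩
    ¬ a ∨ ¬ b                              ∎

  biimp-refl : ∀ x → biimp H x x ≈ ⊤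
  biimp-refl x = Eq.trans (∧-cong ⇨-unit ⇨-unit) (∧-idempotent ⊤)

  biimp-comm : ∀ x y → biimp H x y ≈ biimp H y x
  biimp-comm x y = ∧-comm _ _

  biimp-trans : ∀ x y z → biimp H x y ∧ biimp H y z ≤ biimp H x z
  biimp-trans x y z = ∧-greatest
    (trans (∧-monotonic (x∧y≤x _ _) (x∧y≤x _ _)) (⇨-trans x y z))
    (trans (trans (∧-monotonic (x∧y≤y _ _) (x∧y≤y _ _)) (reflexive (∧-comm _ _))) (⇨-trans z y x))

  biimp-⊤ˡ : ∀ x → biimp H ⊤ x ≈ x
  biimp-⊤ˡ x = Eq.trans (∧-cong (⊤⇨x≈x x) (x⇨⊤≈⊤ x)) (identityʳ x)

  biimp-⊥ʳ : ∀ x → biimp H x ⊥ ≈ ¬ x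
  biimp-⊥ʳ x = antisym (x∧y≤x _ _) (∧-greatest refl (transpose-⇨ (trans (x∧y≤y _ _) (minimum _))))

  sharp-⊤ˡ : ∀ x → sharp H ⊤ x ≈ ¬ x
  sharp-⊤ˡ x = ⇨-cong (biimp-⊤ˡ x) Eq.refl

  sharp-⊥ʳ : ∀ x → sharp H x ⊥ ≈ ¬ ¬ x
  sharp-⊥ʳ x = ⇨-cong (biimp-⊥ʳ x) Eq.refl

  sharp-⊤⊥ : sharp H ⊤ ⊥ ≈ ⊤
  sharp-⊤⊥ = Eq.trans (⇨-cong (biimp-⊤ˡ ⊥) Eq.refl) ⇨-unit

  sharp-irrefl : ∀ x → sharp H x x ≈ ⊥
  sharp-irrefl x = Eq.trans (⇨-cong (biimp-refl x) Eq.refl) ¬⊤≈⊥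

  sharp-sym : ∀ x y → sharp H x y ≈ sharp H y x
  sharp-sym x y = ⇨-cong (biimp-comm x y) Eq.refl

  sharp-cotrans : WeakExcludedMiddle H → ∀ x y z → sharp H x y ≤ sharp H x z ∨ sharp H z y
  sharp-cotrans wem x y z = begin
    ¬ biimp H x y                          ≤⟨ ⇨ˡ-contravariant (biimp-trans x z y) ⟩
    ¬ (biimp H x z ∧ biimp H z y)          ≤⟨ ¬∧≤¬∨¬ _ (wem _) ⟩
    ¬ biimp H x z ∨ ¬ biimp H z y          ∎

  apartness⇒wem : IsApartnessTerm H (sharp H) → WeakExcludedMiddle H
  apartness⇒wem (_ , _ , cotrans) x = antisym (maximum _) (begin
    ⊤                            ≈⟨ Eq.sym sharp-⊤⊥ ⟩
    sharp H ⊤ ⊥                  ≤⟨ cotrans ⊤ ⊥ x ⟩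
    sharp H ⊤ x ∨ sharp H x ⊥    ≤⟨ ∨-monotonic (reflexive (sharp-⊤ˡ x)) (reflexive (sharp-⊥ʳ x)) ⟩
    ¬ x ∨ ¬ ¬ x                  ∎)

  wem⇒apartness : WeakExcludedMiddle H → IsApartnessTerm H (sharp H)
  wem⇒apartness wem = sharp-irrefl , sharp-sym , sharp-cotrans wem

open HeytingLemmas using (apartness⇒wem; wem⇒apartness)

mainTheorem6 : {c ℓ₁ ℓ₂ : Level} (H : HeytingAlgebra c ℓ₁ ℓ₂) →
    IsApartnessTerm H (sharp H) ⇔ WeakExcludedMiddle H
mainTheorem6 H = mk⇔ (apartness⇒wem H) (wem⇒apartness H)
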